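{- Let $G$ be a finite, connected, simple graph with at least two vertices. Let $S\subseteq V(G)$ be a resolving set of $G$, let $x\in S$, and let $T\subseteq V(G)$ be a doubly distance resolving set of $G$ on $x$. Then $S\cup T$ is a doubly resolving set of $G$.
   Context: $d_G(u,v)$ denotes the distance in $G$. A vertex set $S$ is a resolving set of $G$ if for every two distinct vertices $u,v$ there is $y\in S$ with $d_G(u,y)\neq d_G(v,y)$. A pair $\{x,y\}$ of vertices doubly resolves $\{u,v\}$ if $d_G(u,x)-d_G(u,y)\neq d_G(v,x)-d_G(v,y)$. A vertex set $S$ is a doubly resolving set of $G$ if every pair of distinct vertices of $G$ is doubly resolved by some pair of vertices of $S$. Given a vertex $x$, a set $T\subseteq V(G)$ is a doubly distance resolving set of $G$ on $x$ if every pair of vertices $\{u,v\}$ with $d_G(u,x)\neq d_G(v,x)$ is doubly resolved by some pair of vertices in $T\cup\{x\}$. -}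

module Defs where

open import Data.Nat using (ℕ; zero; suc; _≤_)
open import Data.Bool using (Bool; true; false; _∧_; _∨_; T)
open import Data.Fin using (Fin; _≟_)
open import Data.Fin.Subset using (Subset; _∈_; _∪_)
open import Data.Vec.Functional using (foldr; map)
open import Data.Integer using (ℤ; +_; _-_)
open import Data.Product using (Σ; ∃; _×_; _,_)
open import Relation.Binary.PropositionalEquality using (_≡_; _≢_)
open import Relation.Nullary.Decidable using (⌊_⌋)

record Graph (n : ℕ) : Set where
  field
    adj   : Fin n → Fin n → Bool
    sym   : ∀ u v → adj u v ≡ adj v u
    irref : ∀ u → adj u u ≡ false

open Graph public

module _ {n : ℕ} (G : Graph n) where

  data Walk : Fin n → Fin n → ℕ → Set where
    here : ∀ {u} → Walk u u 0
    step : ∀ {u w v k} → T (adj G u w) → Walk w v k → Walk u v (suc k)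

  Connected : Set
  Connected = ∀ u v → ∃ λ k → Walk u v k

  -- reach k u v : is there a walk of length at most k from u to v
  reach : ℕ → Fin n → Fin n → Bool
  reach zero    u v = ⌊ u ≟ v ⌋
  reach (suc k) u v =
    reach k u v ∨ foldr _∨_ false (λ w → reach k u w ∧ adj G w v)

  -- least k ≤ bound with reach k u v (bound returned if none)
  searchFrom : ℕ → ℕ → Fin n → Fin n → ℕ
  searchFrom k zero    u v = k
  searchFrom k (suc b) u v with reach k u v
  ... | true  = k
  ... | false = searchFrom (suc k) b u v

  -- shortest-path distance d_G(u,v) (lengths of shortest walks are < n)
  dist : Fin n → Fin n → ℕ
  dist u v = searchFrom 0 n u v

  diff : Fin n → Fin n → Fin n → ℤ
  diff u x y = (+ dist u x) - (+ dist u y)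

  Resolving : Subset n → Set
  Resolving S = ∀ u v → u ≢ v → ∃ λ y → y ∈ S × dist u y ≢ dist v y

  DoublyResolves : Fin n → Fin n → Fin n → Fin n → Set
  DoublyResolves x y u v = diff u x y ≢ diff v x y

  DoublyResolving : Subset n → Set
  DoublyResolving S = ∀ u v → u ≢ v →
    ∃ λ x → ∃ λ y → x ∈ S × y ∈ S × DoublyResolves x y u v

  DoublyDistResolvingOn : Fin n → Subset n → Set
  DoublyDistResolvingOn x T = ∀ u v → dist u x ≢ dist v x →
    ∃ λ a → ∃ λ b → (a ≡ x ⊎' a ∈ T) × (b ≡ x ⊎' b ∈ T) × DoublyResolves a b u v
    where
      open import Data.Sum using () renaming (_⊎_ to _⊎'_)

-- Let u ≠ v. If x does not see u and v at the same distance, some pair from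
-- T ∪ {x} doubly resolves them by assumption. Otherwise take y ∈ S resolving
-- u and v: as d(u,x) = d(v,x), the differences d(·,x) − d(·,y) at u and v
-- differ exactly because d(u,y) ≠ d(v,y), so {x, y} ⊆ S doubly resolves them.
module Submission where

open import Defs
open import Data.Nat using (ℕ; _≤_)
import Data.Nat.Properties as ℕ
open import Data.Fin using (Fin)
open import Data.Fin.Subset using (Subset; _∈_; _∪_)
open import Data.Fin.Subset.Properties using (x∈p∪q⁺)
open import Data.Integer using (ℤ; +_; _-_; -_)
import Data.Integer.Properties as ℤ
open import Algebra.Properties.AbelianGroup ℤ.+-0-abelianGroup using (∙-cancelˡ)
open import Data.Sum using (_⊎_; inj₁; inj₂)
open import Data.Product using (_,_)
open import Relation.Binary.PropositionalEquality using (_≡_; _≢_; refl)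
open import Relation.Nullary using (yes; no)

-‿cancelˡ : ∀ (a b c : ℤ) → a - b ≡ a - c → b ≡ c
-‿cancelˡ a b c eq = ℤ.neg-injective (∙-cancelˡ a (- b) (- c) eq)

module _ {n : ℕ} (G : Graph n) where

  equidistant∧resolves⇒doublyResolves : ∀ {x y u v} →
    dist G u x ≡ dist G v x → dist G u y ≢ dist G v y →
    DoublyResolves G x y u v
  equidistant∧resolves⇒doublyResolves {x} {y} {u} {v} u≡v[x] u≢v[y] d
    rewrite u≡v[x] =
      u≢v[y] (ℤ.+-injective (-‿cancelˡ (+ dist G v x) _ _ d))

  ≡∨∈⇒∈∪ : ∀ {S T : Subset n} {x z} → x ∈ S → z ≡ x ⊎ z ∈ T → z ∈ S ∪ T
  ≡∨∈⇒∈∪ x∈S (inj₁ refl) = x∈p∪q⁺ (inj₁ x∈S)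
  ≡∨∈⇒∈∪ x∈S (inj₂ z∈T)  = x∈p∪q⁺ (inj₂ z∈T)

lemma2 : ∀ {n} (G : Graph n) → 2 ≤ n → Connected G →
    (S T : Subset n) (x : Fin n) →
    Resolving G S → x ∈ S → DoublyDistResolvingOn G x T →
    DoublyResolving G (S ∪ T)
lemma2 G _ _ S T x resolving x∈S onX u v u≢v with dist G u x ℕ.≟ dist G v x
... | no u≢v[x] with onX u v u≢v[x]
...   | a , b , a∈ , b∈ , resolves =
        a , b , ≡∨∈⇒∈∪ G x∈S a∈ , ≡∨∈⇒∈∪ G x∈S b∈ , resolves
lemma2 G _ _ S T x resolving x∈S onX u v u≢v | yes u≡v[x] with resolving u v u≢v
... | y , y∈S , u≢v[y] =
      x , y , x∈p∪q⁺ (inj₁ x∈S) , x∈p∪q⁺ (inj₁ y∈S) ,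
      equidistant∧resolves⇒doublyResolves G u≡v[x] u≢v[y]
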